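{- Let $t\mid m\mid n$. If there is a group divisible triangle design of order $n$ with groups of dimension $m$ over $\mathbb{F}_q$ and a group divisible triangle design of order $m$ with groups of dimension $t$ over $\mathbb{F}_q$, then there is a group divisible triangle design of order $n$ with groups of dimension $t$ over $\mathbb{F}_q$ (in particular, a triangle design in $\mathbb{F}_q^n$ if $t=1$). If both given designs are balanced, then there is a balanced such design of order $n$ with groups of dimension $t$.
   Context: A triangle is a set $\{\langle a,b\rangle,\langle b,c\rangle,\langle c,a\rangle\}$ of $2$-dimensional $\mathbb{F}_q$-subspaces with $a,b,c$ linearly independent. A group divisible triangle design of order $n$ with groups of dimension $m$ over $\mathbb{F}_q$ ($m\mid n$) is a triple $(V,\mathcal{G},\mathcal{B})$: $V$ an $n$-dimensional $\mathbb{F}_q$-space, $\mathcal{G}$ a set of $m$-dimensional subspaces such that every nonzero vector lies in exactly one, and $\mathcal{B}$ a set of triangles such that every $2$-dimensional subspace either belongs to exactly one triangle of $\mathcal{B}$ and to no group, or to no triangle and to one group. With $m=1$ (groups the $1$-dimensional subspaces) this is the same as a triangle design: a set of triangles such that every $2$-dimensional subspace belongs to exactly one of them. A design is balanced if every nonzero vector lies in a subspace of the same number of its triangles. -}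

module Defs where

open import Data.Nat using (ℕ; zero; suc)
open import Data.Fin using (Fin; zero; suc)
open import Data.List using (List; length)
open import Data.List.Membership.Propositional using (_∈_)
open import Data.List.Relation.Unary.Unique.Propositional using (Unique)
open import Data.Product using (Σ; ∃; _×_; _,_)
open import Data.Sum using (_⊎_)
open import Relation.Nullary using (¬_)
open import Relation.Binary.PropositionalEquality using (_≡_)
open import Algebra.Structures using (IsCommutativeRing)

record FiniteField : Set₁ where
  infixl 6 _+_
  infixl 7 _*_
  field
    Carrier : Set
    _+_ _*_ : Carrier → Carrier → Carrier
    -_      : Carrier → Carrier
    0# 1#   : Carrier
    isCommutativeRing : IsCommutativeRing _≡_ _+_ _*_ -_ 0# 1#
    0≢1     : ¬ (0# ≡ 1#)
    inverse : ∀ x → ¬ (x ≡ 0#) → ∃ λ y → x * y ≡ 1#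
    elements : List Carrier
    complete : ∀ x → x ∈ elements

module _ (F : FiniteField) where
  open FiniteField F

  Vect : ℕ → Set
  Vect n = Fin n → Carrier

  0v : ∀ {n} → Vect n
  0v _ = 0#

  _+v_ : ∀ {n} → Vect n → Vect n → Vect n
  (x +v y) i = x i + y i

  _•_ : ∀ {n} → Carrier → Vect n → Vect n
  (a • x) i = a * x i

  _≈v_ : ∀ {n} → Vect n → Vect n → Set
  x ≈v y = ∀ i → x i ≡ y i

  NonzeroV : ∀ {n} → Vect n → Set
  NonzeroV v = ¬ (v ≈v 0v)

  lincomb : ∀ {n k} → (Fin k → Carrier) → (Fin k → Vect n) → Vect n
  lincomb {k = zero}  c u = 0v
  lincomb {k = suc k} c u = (c zero • u zero) +v lincomb (λ i → c (suc i)) (λ i → u (suc i))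

  LinIndep : ∀ {n k} → (Fin k → Vect n) → Set
  LinIndep u = ∀ c → lincomb c u ≈v 0v → ∀ i → c i ≡ 0#

  InSpan : ∀ {n k} → Vect n → (Fin k → Vect n) → Set
  InSpan v u = ∃ λ c → lincomb c u ≈v v

  SubSpan : ∀ {n k l} → (Fin k → Vect n) → (Fin l → Vect n) → Set
  SubSpan {n} u w = (v : Vect n) → InSpan v u → InSpan v w

  SameSpan : ∀ {n k l} → (Fin k → Vect n) → (Fin l → Vect n) → Set
  SameSpan u w = SubSpan u w × SubSpan w u

  pair : ∀ {n} → Vect n → Vect n → Fin 2 → Vect n
  pair x y zero = x
  pair x y (suc _) = y

  triple : ∀ {n} → Vect n → Vect n → Vect n → Fin 3 → Vect n
  triple x y z zero = x
  triple x y z (suc zero) = y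
  triple x y z (suc (suc _)) = z

  -- triangle {<a,b>, <b,c>, <c,a>} with a, b, c linearly independent
  record Triangle (n : ℕ) : Set where
    field
      a b c : Vect n
      indep : LinIndep (triple a b c)

  IsSide : ∀ {n} → (Fin 2 → Vect n) → Triangle n → Set
  IsSide w T = SameSpan w (pair a b) ⊎ SameSpan w (pair b c) ⊎ SameSpan w (pair c a)
    where open Triangle T

  OnTriangle : ∀ {n} → Vect n → Triangle n → Set
  OnTriangle v T = InSpan v (pair a b) ⊎ InSpan v (pair b c) ⊎ InSpan v (pair c a)
    where open Triangle T

  -- Groups are m-dim subspaces, each given by a basis; blocks are triangles.
  -- Sets are indexed families; "exactly one" is uniqueness of the index,
  -- which in particular forbids repeated members.
  record GDTD (n m : ℕ) : Set where
    field
      numGroups : ℕ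
      groups    : Fin numGroups → Fin m → Vect n
      groups-indep : ∀ i → LinIndep (groups i)
      numBlocks : ℕ
      blocks    : Fin numBlocks → Triangle n
      points : (v : Vect n) → NonzeroV v →
        ∃ λ i → InSpan v (groups i) × (∀ i' → InSpan v (groups i') → i' ≡ i)
      lines : (w : Fin 2 → Vect n) → LinIndep w →
          ((∃ λ j → IsSide w (blocks j) × (∀ j' → IsSide w (blocks j') → j' ≡ j))
            × (∀ i → ¬ SubSpan w (groups i)))
        ⊎ ((∀ j → ¬ IsSide w (blocks j))
            × (∃ λ i → SubSpan w (groups i) × (∀ i' → SubSpan w (groups i') → i' ≡ i)))

  Balanced : ∀ {n m} → GDTD n m → Set
  Balanced {n} D = ∃ λ (r : ℕ) → (v : Vect n) → NonzeroV v →
      Σ (List (Fin numBlocks)) λ S → Unique S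
        × (∀ j → (j ∈ S → OnTriangle v (blocks j)) × (OnTriangle v (blocks j) → j ∈ S))
        × length S ≡ r
    where open GDTD D

{-# OPTIONS --safe #-}
module Submission where

-- Fix a basis of every group G of the first design; the coordinate map F^m → G it defines
-- is a linear isomorphism, so the second design can be copied into every group.  The new
-- design keeps the triangles of the first design, adds all the copied triangles, and takes
-- the copied groups as its groups.  A 2-subspace is either a side of a unique triangle of the
-- first design, or it lies in a unique group G, where the copy of the second design covers it
-- exactly once.  A nonzero vector lies in a unique group G, so it is on r₁ triangles of the
-- first design and on r₂ triangles of the copy inside G, and on no other copied triangle.

open import Defs
open import Algebra.Bundles using (CommutativeRing)
open import Algebra.Structures using (IsCommutativeRing)
import Algebra.Properties.AbelianGroup as AbelianGroupProperties
import Algebra.Properties.CommutativeSemigroup as CommutativeSemigroupProperties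
import Algebra.Properties.Group as GroupProperties
import Algebra.Properties.Ring as RingProperties
open import Data.Empty using (⊥-elim)
open import Data.Fin using (Fin; zero; suc)
open import Data.Fin.Properties using (+↔⊎; *↔×)
open import Data.List using (List; length; map; _++_)
open import Data.List.Membership.Propositional using (_∈_)
open import Data.List.Membership.Propositional.Properties using (∈-map⁺; ∈-map⁻; ∈-++⁺ˡ; ∈-++⁺ʳ; ∈-++⁻)
open import Data.List.Properties using (length-map; length-++)
open import Data.List.Relation.Unary.Unique.Propositional using (Unique)
import Data.List.Relation.Unary.Unique.Propositional.Properties as Unique
open import Data.Nat as ℕ using (ℕ)
open import Data.Nat.Divisibility using (_∣_)
open import Data.Product using (Σ; ∃; _×_; _,_; proj₁; proj₂)
import Data.Product as Product
open import Data.Product.Function.NonDependent.Propositional using (_×-⇔_)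
open import Data.Product.Properties using (,-injectiveʳ)
open import Data.Sum using (_⊎_; inj₁; inj₂; [_,_])
import Data.Sum as Sum
open import Data.Sum.Function.Propositional using (_⊎-⇔_; _⊎-↔_)
open import Data.Sum.Properties using (inj₁-injective; inj₂-injective)
open import Function using (_∘_; _↔_; _⇔_; mk⇔; Inverse; Equivalence; Injection)
open import Function.Construct.Composition using (_↔-∘_)
open import Function.Construct.Identity using (↔-id)
open import Function.Construct.Symmetry using (⇔-sym; ↔-sym)
open import Function.Properties.Inverse using (↔⇒↣)
open import Relation.Nullary using (¬_)
open import Relation.Binary.PropositionalEquality using (_≡_; refl; sym; trans; cong; cong₂; subst; module ≡-Reasoning)

open Equivalence using (to; from)

private
  variable
    A A′ B B′ C D : Set

ExactlyOne : (A → Set) → Set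
ExactlyOne P = ∃ λ a → P a × (∀ a′ → P a′ → a′ ≡ a)

ExactlyOne⊎ : (A → Set) → (B → Set) → Set
ExactlyOne⊎ P Q = (ExactlyOne P × (∀ b → ¬ Q b)) ⊎ ((∀ a → ¬ P a) × ExactlyOne Q)

module _ {P Q : A → Set} (P⇔Q : ∀ a → P a ⇔ Q a) where

  exactlyOne-⇔ : ExactlyOne P → ExactlyOne Q
  exactlyOne-⇔ (a , pa , unique) = a , to (P⇔Q a) pa , λ a′ → unique a′ ∘ from (P⇔Q a′)

  none-⇔ : (∀ a → ¬ P a) → ∀ a → ¬ Q a
  none-⇔ none a = none a ∘ from (P⇔Q a)

exactlyOne⊎-⇔ : {P P′ : A → Set} {Q Q′ : B → Set} →
  (∀ a → P a ⇔ P′ a) → (∀ b → Q b ⇔ Q′ b) → ExactlyOne⊎ P Q → ExactlyOne⊎ P′ Q′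
exactlyOne⊎-⇔ P⇔P′ Q⇔Q′ =
  Sum.map (Product.map (exactlyOne-⇔ P⇔P′) (none-⇔ Q⇔Q′))
          (Product.map (none-⇔ P⇔P′) (exactlyOne-⇔ Q⇔Q′))

exactlyOne-↔ : {P : B → Set} (e : A ↔ B) → ExactlyOne P → ExactlyOne (P ∘ Inverse.to e)
exactlyOne-↔ {P = P} e (b , pb , unique) =
  from e b , subst P (sym (strictlyInverseˡ e b)) pb ,
  λ a pa → trans (sym (strictlyInverseʳ e a)) (cong (from e) (unique (to e a) pa))
  where open Inverse

exactlyOne⊎-↔ : {P : A′ → Set} {Q : B′ → Set} (e : A ↔ A′) (f : B ↔ B′) →
  ExactlyOne⊎ P Q → ExactlyOne⊎ (P ∘ Inverse.to e) (Q ∘ Inverse.to f)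
exactlyOne⊎-↔ e f =
  Sum.map (Product.map (exactlyOne-↔ e) (λ none → none ∘ Inverse.to f))
          (Product.map (λ none → none ∘ Inverse.to e) (exactlyOne-↔ f))

module _ {P : A ⊎ B → Set} where

  exactlyOne-inj₁ : ExactlyOne (P ∘ inj₁) → (∀ b → ¬ P (inj₂ b)) → ExactlyOne P
  exactlyOne-inj₁ (a , pa , unique) none = inj₁ a , pa , λ
    { (inj₁ a′) pa′ → cong inj₁ (unique a′ pa′)
    ; (inj₂ b) pb → ⊥-elim (none b pb) }

  exactlyOne-inj₂ : (∀ a → ¬ P (inj₁ a)) → ExactlyOne (P ∘ inj₂) → ExactlyOne P
  exactlyOne-inj₂ none (b , pb , unique) = inj₂ b , pb , λ
    { (inj₁ a) pa → ⊥-elim (none a pa)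
    ; (inj₂ b′) pb′ → cong inj₂ (unique b′ pb′) }

module _ {Q : B → Set} {R : B × C → Set} (R⇒Q : ∀ {b c} → R (b , c) → Q b) where

  exactlyOne-× : (one-Q : ExactlyOne Q) → ExactlyOne (λ c → R (proj₁ one-Q , c)) → ExactlyOne R
  exactlyOne-× (b , _ , unique-b) (c , rbc , unique-c) = (b , c) , rbc , unique
    where
    unique : ∀ p → R p → p ≡ (b , c)
    unique (b′ , c′) r with unique-b b′ (R⇒Q r)
    ... | refl = cong (b ,_) (unique-c c′ r)

  none-× : (one-Q : ExactlyOne Q) → (∀ c → ¬ R (proj₁ one-Q , c)) → ∀ p → ¬ R p
  none-× (b , _ , unique-b) none (b′ , c) r with unique-b b′ (R⇒Q r)
  ... | refl = none c r

exactlyOne⊎-refine : {P : A ⊎ (B × C) → Set} {Q : B → Set} {S : B × D → Set} →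
  (∀ {b c} → P (inj₂ (b , c)) → Q b) → (∀ {b d} → S (b , d) → Q b) →
  ExactlyOne⊎ (P ∘ inj₁) Q →
  (∀ {b} → Q b → ExactlyOne⊎ (λ c → P (inj₂ (b , c))) (λ d → S (b , d))) →
  ExactlyOne⊎ P S
exactlyOne⊎-refine P⇒Q S⇒Q (inj₁ (one-P , none-Q)) _ =
  inj₁ ( exactlyOne-inj₁ one-P (λ { (b , _) p → none-Q b (P⇒Q p) })
       , λ { (b , _) s → none-Q b (S⇒Q s) })
exactlyOne⊎-refine P⇒Q S⇒Q (inj₂ (none-P , one-Q@(_ , qb , _))) fibre with fibre qb
... | inj₁ (one-R , none-S) =
  inj₁ (exactlyOne-inj₂ none-P (exactlyOne-× P⇒Q one-Q one-R) , none-× S⇒Q one-Q none-S)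
... | inj₂ (none-R , one-S) =
  inj₂ ([ none-P , none-× P⇒Q one-Q none-R ] , exactlyOne-× S⇒Q one-Q one-S)

Enumerates : (A → Set) → List A → Set
Enumerates P S = Unique S × (∀ a → (a ∈ S → P a) × (P a → a ∈ S))

∈-map-injective : {f : A → B} {a : A} {S : List A} →
  (∀ {x y} → f x ≡ f y → x ≡ y) → f a ∈ map f S → a ∈ S
∈-map-injective {f = f} f-injective fa∈ with ∈-map⁻ f fa∈
... | _ , a′∈S , fa≡fa′ = subst (_∈ _) (sym (f-injective fa≡fa′)) a′∈S

enumerates-⇔ : {P Q : A → Set} {S : List A} → (∀ a → P a ⇔ Q a) → Enumerates P S → Enumerates Q S
enumerates-⇔ P⇔Q (unique , members) =
  unique , λ a → to (P⇔Q a) ∘ proj₁ (members a) , proj₂ (members a) ∘ from (P⇔Q a)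

enumerates-↔ : {P : B → Set} {S : List B} (e : A ↔ B) →
  Enumerates P S → Enumerates (P ∘ Inverse.to e) (map (Inverse.from e) S)
enumerates-↔ {S = S} e (unique , members) = Unique.map⁺ from-injective unique , λ a →
    (λ a∈ → proj₁ (members (to e a)) (∈-map-injective from-injective
                                        (subst (_∈ map (from e) S) (sym (strictlyInverseʳ e a)) a∈)))
  , (λ pa → subst (_∈ map (from e) S) (strictlyInverseʳ e a) (∈-map⁺ (from e) (proj₂ (members (to e a)) pa)))
  where
  open Inverse
  from-injective : ∀ {x y} → from e x ≡ from e y → x ≡ y
  from-injective = Injection.injective (↔⇒↣ (↔-sym e))

module _ {S : List A} {T : List B} where

  ∈-++-inj₁ : ∀ {a} → inj₁ a ∈ map inj₁ S ++ map inj₂ T → a ∈ S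
  ∈-++-inj₁ a∈ with ∈-++⁻ (map inj₁ S) a∈
  ... | inj₁ a∈S = ∈-map-injective inj₁-injective a∈S
  ... | inj₂ a∈T with ∈-map⁻ inj₂ a∈T
  ...   | _ , _ , ()

  ∈-++-inj₂ : ∀ {b} → inj₂ b ∈ map inj₁ S ++ map inj₂ T → b ∈ T
  ∈-++-inj₂ b∈ with ∈-++⁻ (map inj₁ S) b∈
  ... | inj₂ b∈T = ∈-map-injective inj₂-injective b∈T
  ... | inj₁ b∈S with ∈-map⁻ inj₁ b∈S
  ...   | _ , _ , ()

  enumerates-⊎ : {P : A ⊎ B → Set} →
    Enumerates (P ∘ inj₁) S → Enumerates (P ∘ inj₂) T → Enumerates P (map inj₁ S ++ map inj₂ T)
  enumerates-⊎ {P} (unique-S , members-S) (unique-T , members-T) =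
    Unique.++⁺ (Unique.map⁺ inj₁-injective unique-S) (Unique.map⁺ inj₂-injective unique-T) disjoint ,
    members
    where
    disjoint : ∀ {x} → ¬ (x ∈ map inj₁ S × x ∈ map inj₂ T)
    disjoint (x∈S , x∈T) with ∈-map⁻ inj₁ x∈S | ∈-map⁻ inj₂ x∈T
    ... | _ , _ , refl | _ , _ , ()

    members : ∀ x → (x ∈ map inj₁ S ++ map inj₂ T → P x) × (P x → x ∈ map inj₁ S ++ map inj₂ T)
    members (inj₁ a) = proj₁ (members-S a) ∘ ∈-++-inj₁ , ∈-++⁺ˡ ∘ ∈-map⁺ inj₁ ∘ proj₂ (members-S a)
    members (inj₂ b) = proj₁ (members-T b) ∘ ∈-++-inj₂ , ∈-++⁺ʳ (map inj₁ S) ∘ ∈-map⁺ inj₂ ∘ proj₂ (members-T b)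

enumerates-fibre : {R : B × C → Set} {b : B} {S : List C} →
  (∀ {b′ c} → R (b′ , c) → b′ ≡ b) → Enumerates (λ c → R (b , c)) S → Enumerates R (map (b ,_) S)
enumerates-fibre {R = R} {b} {S} in-fibre (unique , members) =
  Unique.map⁺ ,-injectiveʳ unique , λ { (b′ , c) → forward , backward }
  where
  forward : ∀ {p} → p ∈ map (b ,_) S → R p
  forward p∈ with ∈-map⁻ (b ,_) p∈
  ... | c , c∈S , refl = proj₁ (members c) c∈S

  backward : ∀ {b′ c} → R (b′ , c) → (b′ , c) ∈ map (b ,_) S
  backward r with in-fibre r
  ... | refl = ∈-map⁺ (b ,_) (proj₂ (members _) r)

module _ (F : FiniteField) where
  open FiniteField F
  open IsCommutativeRing isCommutativeRing
    using (+-identityˡ; +-identityʳ; zeroˡ; zeroʳ; distribˡ; distribʳ; *-assoc; *-identityˡ; -‿inverseʳ)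

  private
    commutativeRing : CommutativeRing _ _
    commutativeRing = record { isCommutativeRing = isCommutativeRing }
    open CommutativeRing commutativeRing using (ring; +-group; +-abelianGroup; +-commutativeSemigroup)
    open RingProperties ring using (-‿distribˡ-*)
    open GroupProperties +-group using (ε⁻¹≈ε; x∙y⁻¹≈ε⇒x≈y)
    open AbelianGroupProperties +-abelianGroup using (⁻¹-∙-comm)
    open CommutativeSemigroupProperties +-commutativeSemigroup using (interchange)

  infix 4 _≈_
  _≈_ : ∀ {n} → Vect F n → Vect F n → Set
  _≈_ = _≈v_ F

  standardBasis : ∀ {k} → Fin k → Vect F k
  standardBasis zero    zero    = 1#
  standardBasis zero    (suc _) = 0#
  standardBasis (suc _) zero    = 0#
  standardBasis (suc j) (suc i) = standardBasis j i

  module _ {n : ℕ} where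
    open ≡-Reasoning

    lincomb-cong : ∀ {k} {c d : Fin k → Carrier} {u w : Fin k → Vect F n} →
      (∀ i → c i ≡ d i) → (∀ i → u i ≈ w i) → lincomb F c u ≈ lincomb F d w
    lincomb-cong {ℕ.zero} c≡d u≈w l = refl
    lincomb-cong {ℕ.suc k} c≡d u≈w l =
      cong₂ _+_ (cong₂ _*_ (c≡d zero) (u≈w zero l)) (lincomb-cong (c≡d ∘ suc) (u≈w ∘ suc) l)

    lincomb-0 : ∀ {k} (u : Fin k → Vect F n) → lincomb F (λ _ → 0#) u ≈ 0v F
    lincomb-0 {ℕ.zero} u l = refl
    lincomb-0 {ℕ.suc k} u l = begin
      0# * u zero l + lincomb F (λ _ → 0#) (u ∘ suc) l ≡⟨ cong₂ _+_ (zeroˡ _) (lincomb-0 (u ∘ suc) l) ⟩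
      0# + 0#                                          ≡⟨ +-identityˡ 0# ⟩
      0#                                               ∎

    lincomb-+ : ∀ {k} (c d : Fin k → Carrier) (u : Fin k → Vect F n) →
      lincomb F (λ i → c i + d i) u ≈ _+v_ F (lincomb F c u) (lincomb F d u)
    lincomb-+ {ℕ.zero} c d u l = sym (+-identityˡ 0#)
    lincomb-+ {ℕ.suc k} c d u l = begin
      (c zero + d zero) * u zero l + lincomb F (λ i → c (suc i) + d (suc i)) (u ∘ suc) l
        ≡⟨ cong₂ _+_ (distribʳ (u zero l) (c zero) (d zero)) (lincomb-+ (c ∘ suc) (d ∘ suc) (u ∘ suc) l) ⟩
      (c zero * u zero l + d zero * u zero l) + (lincomb F (c ∘ suc) (u ∘ suc) l + lincomb F (d ∘ suc) (u ∘ suc) l)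
        ≡⟨ interchange _ _ _ _ ⟩
      (c zero * u zero l + lincomb F (c ∘ suc) (u ∘ suc) l) + (d zero * u zero l + lincomb F (d ∘ suc) (u ∘ suc) l)
        ∎

    lincomb-• : ∀ {k} a (c : Fin k → Carrier) (u : Fin k → Vect F n) →
      lincomb F (λ i → a * c i) u ≈ _•_ F a (lincomb F c u)
    lincomb-• {ℕ.zero} a c u l = sym (zeroʳ a)
    lincomb-• {ℕ.suc k} a c u l = begin
      (a * c zero) * u zero l + lincomb F (λ i → a * c (suc i)) (u ∘ suc) l
        ≡⟨ cong₂ _+_ (*-assoc a (c zero) (u zero l)) (lincomb-• a (c ∘ suc) (u ∘ suc) l) ⟩
      a * (c zero * u zero l) + a * lincomb F (c ∘ suc) (u ∘ suc) l
        ≡⟨ distribˡ a _ _ ⟨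
      a * (c zero * u zero l + lincomb F (c ∘ suc) (u ∘ suc) l)
        ∎

    lincomb-neg : ∀ {k} (c : Fin k → Carrier) (u : Fin k → Vect F n) →
      lincomb F (λ i → - c i) u ≈ (λ l → - lincomb F c u l)
    lincomb-neg {ℕ.zero} c u l = sym ε⁻¹≈ε
    lincomb-neg {ℕ.suc k} c u l = begin
      (- c zero) * u zero l + lincomb F (λ i → - c (suc i)) (u ∘ suc) l
        ≡⟨ cong₂ _+_ (sym (-‿distribˡ-* (c zero) (u zero l))) (lincomb-neg (c ∘ suc) (u ∘ suc) l) ⟩
      - (c zero * u zero l) + - lincomb F (c ∘ suc) (u ∘ suc) l
        ≡⟨ ⁻¹-∙-comm _ _ ⟩
      - (c zero * u zero l + lincomb F (c ∘ suc) (u ∘ suc) l)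
        ∎

    lincomb-lincomb : ∀ {m k} (c : Fin k → Carrier) (u : Fin k → Vect F m) (g : Fin m → Vect F n) →
      lincomb F (lincomb F c u) g ≈ lincomb F c (λ j → lincomb F (u j) g)
    lincomb-lincomb {k = ℕ.zero} c u g = lincomb-0 g
    lincomb-lincomb {k = ℕ.suc k} c u g l = begin
      lincomb F (λ i → c zero * u zero i + lincomb F (c ∘ suc) (u ∘ suc) i) g l
        ≡⟨ lincomb-+ (λ i → c zero * u zero i) (lincomb F (c ∘ suc) (u ∘ suc)) g l ⟩
      lincomb F (λ i → c zero * u zero i) g l + lincomb F (lincomb F (c ∘ suc) (u ∘ suc)) g l
        ≡⟨ cong₂ _+_ (lincomb-• (c zero) (u zero) g l) (lincomb-lincomb (c ∘ suc) (u ∘ suc) g l) ⟩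
      c zero * lincomb F (u zero) g l + lincomb F (c ∘ suc) (λ j → lincomb F (u (suc j)) g) l
        ∎

    lincomb-injective : ∀ {k} {u : Fin k → Vect F n} → LinIndep F u →
      ∀ {c d} → lincomb F c u ≈ lincomb F d u → ∀ i → c i ≡ d i
    lincomb-injective {u = u} u-indep {c} {d} cu≈du i =
      x∙y⁻¹≈ε⇒x≈y _ _ (u-indep (λ i → c i + - d i) difference-0 i)
      where
      difference-0 : lincomb F (λ i → c i + - d i) u ≈ 0v F
      difference-0 l = begin
        lincomb F (λ i → c i + - d i) u l           ≡⟨ lincomb-+ c (λ i → - d i) u l ⟩
        lincomb F c u l + lincomb F (λ i → - d i) u l ≡⟨ cong₂ _+_ (cu≈du l) (lincomb-neg d u l) ⟩
        lincomb F d u l + - lincomb F d u l         ≡⟨ -‿inverseʳ _ ⟩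
        0#                                          ∎

    lincomb-standardBasis : ∀ {k} (u : Fin k → Vect F n) j → lincomb F (standardBasis j) u ≈ u j
    lincomb-standardBasis u zero l = begin
      1# * u zero l + lincomb F (λ _ → 0#) (u ∘ suc) l ≡⟨ cong₂ _+_ (*-identityˡ _) (lincomb-0 (u ∘ suc) l) ⟩
      u zero l + 0#                                    ≡⟨ +-identityʳ _ ⟩
      u zero l                                         ∎
    lincomb-standardBasis u (suc j) l = begin
      0# * u zero l + lincomb F (standardBasis j) (u ∘ suc) l
        ≡⟨ cong₂ _+_ (zeroˡ _) (lincomb-standardBasis (u ∘ suc) j l) ⟩
      0# + u (suc j) l
        ≡⟨ +-identityˡ _ ⟩
      u (suc j) l
        ∎

  inSpan-member : ∀ {n k} (u : Fin k → Vect F n) j → InSpan F (u j) u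
  inSpan-member u j = standardBasis j , lincomb-standardBasis u j

  subSpan⇔members : ∀ {n k l} {w : Fin k → Vect F n} {u : Fin l → Vect F n} →
    SubSpan F w u ⇔ (∀ j → InSpan F (w j) u)
  subSpan⇔members {w = w} {u} = mk⇔
    (λ w⊆u j → w⊆u (w j) (inSpan-member w j))
    (λ members v → λ { (c , cw≈v) → lincomb F c (proj₁ ∘ members) , λ l →
       trans (lincomb-lincomb c (proj₁ ∘ members) u l)
             (trans (lincomb-cong (λ _ → refl) (proj₂ ∘ members) l) (cw≈v l)) })

  pair⊆ : ∀ {n k} {x y : Vect F n} {u : Fin k → Vect F n} →
    InSpan F x u → InSpan F y u → SubSpan F (pair F x y) u
  pair⊆ {x = x} {y} x∈u y∈u = from (subSpan⇔members {w = pair F x y}) λ { zero → x∈u ; (suc _) → y∈u }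

  module _ {n k} (T : Triangle F n) {u : Fin k → Vect F n} where
    open Triangle T

    isSide⇒subSpan : InSpan F a u → InSpan F b u → InSpan F c u →
      ∀ {w} → IsSide F w T → SubSpan F w u
    isSide⇒subSpan a∈u b∈u c∈u (inj₁ (w⊆ab , _))        v = pair⊆ a∈u b∈u v ∘ w⊆ab v
    isSide⇒subSpan a∈u b∈u c∈u (inj₂ (inj₁ (w⊆bc , _))) v = pair⊆ b∈u c∈u v ∘ w⊆bc v
    isSide⇒subSpan a∈u b∈u c∈u (inj₂ (inj₂ (w⊆ca , _))) v = pair⊆ c∈u a∈u v ∘ w⊆ca v

    onTriangle⇒inSpan : InSpan F a u → InSpan F b u → InSpan F c u →
      ∀ {v} → OnTriangle F v T → InSpan F v u
    onTriangle⇒inSpan a∈u b∈u c∈u = [ pair⊆ a∈u b∈u _ , [ pair⊆ b∈u c∈u _ , pair⊆ c∈u a∈u _ ] ]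

  module Embedding {n m} (g : Fin m → Vect F n) (g-indep : LinIndep F g) where

    embed : Vect F m → Vect F n
    embed x = lincomb F x g

    infix 4 _↦_
    _↦_ : Vect F m → Vect F n → Set
    x ↦ v = embed x ≈ v

    embed-cong : ∀ {x y} → x ≈ y → embed x ≈ embed y
    embed-cong x≈y = lincomb-cong x≈y (λ _ _ → refl)

    embed-injective : ∀ {x y} → embed x ≈ embed y → x ≈ y
    embed-injective = lincomb-injective g-indep

    ↦-injective : ∀ {x y v} → x ↦ v → y ↦ v → x ≈ y
    ↦-injective x↦v y↦v = embed-injective λ l → trans (x↦v l) (sym (y↦v l))

    lincomb-↦ : ∀ {k} (c : Fin k → Carrier) {u : Fin k → Vect F m} {u′ : Fin k → Vect F n} →
      (∀ j → u j ↦ u′ j) → lincomb F c u ↦ lincomb F c u′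
    lincomb-↦ c {u} u↦u′ l = trans (lincomb-lincomb c u g l) (lincomb-cong (λ _ → refl) u↦u′ l)

    nonzero-↦ : ∀ {x v} → x ↦ v → NonzeroV F v → NonzeroV F x
    nonzero-↦ x↦v v≢0 x≈0 = v≢0 λ l → trans (sym (x↦v l)) (trans (embed-cong x≈0 l) (lincomb-0 g l))

    module _ {k} {u : Fin k → Vect F m} {u′ : Fin k → Vect F n} (u↦u′ : ∀ j → u j ↦ u′ j) where

      inSpan-embed⇔ : ∀ {x v} → x ↦ v → InSpan F v u′ ⇔ InSpan F x u
      inSpan-embed⇔ x↦v = mk⇔
        (λ { (c , cu′≈v) → c , ↦-injective (λ l → trans (lincomb-↦ c u↦u′ l) (cu′≈v l)) x↦v })
        (λ { (c , cu≈x) → c , λ l → trans (sym (lincomb-↦ c u↦u′ l)) (trans (embed-cong cu≈x l) (x↦v l)) })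

      subSpan-embed⇔ : ∀ {l} {w : Fin l → Vect F m} {w′ : Fin l → Vect F n} →
        (∀ j → w j ↦ w′ j) → SubSpan F w′ u′ ⇔ SubSpan F w u
      subSpan-embed⇔ w↦w′ = mk⇔
        (λ w′⊆u′ → from subSpan⇔members λ j → to (inSpan-embed⇔ (w↦w′ j)) (to subSpan⇔members w′⊆u′ j))
        (λ w⊆u → from subSpan⇔members λ j → from (inSpan-embed⇔ (w↦w′ j)) (to subSpan⇔members w⊆u j))

      linIndep-embed⇔ : LinIndep F u′ ⇔ LinIndep F u
      linIndep-embed⇔ = mk⇔
        (λ u′-indep c cu≈0 → u′-indep c λ l →
           trans (sym (lincomb-↦ c u↦u′ l)) (trans (embed-cong cu≈0 l) (lincomb-0 g l)))
        (λ u-indep c cu′≈0 → u-indep c (embed-injective λ l →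
           trans (lincomb-↦ c u↦u′ l) (trans (cu′≈0 l) (sym (lincomb-0 g l)))))

    pair-↦ : ∀ {x y} j → pair F x y j ↦ pair F (embed x) (embed y) j
    pair-↦ zero    _ = refl
    pair-↦ (suc _) _ = refl

    sameSpan-embed⇔ : ∀ {w : Fin 2 → Vect F m} {w′ : Fin 2 → Vect F n} {x y} →
      (∀ j → w j ↦ w′ j) → SameSpan F w′ (pair F (embed x) (embed y)) ⇔ SameSpan F w (pair F x y)
    sameSpan-embed⇔ w↦w′ = subSpan-embed⇔ pair-↦ w↦w′ ×-⇔ subSpan-embed⇔ w↦w′ pair-↦

    embedTriangle : Triangle F m → Triangle F n
    embedTriangle T = record
      { a = embed a ; b = embed b ; c = embed c ; indep = from (linIndep-embed⇔ triple-↦) indep }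
      where
      open Triangle T
      triple-↦ : ∀ j → triple F a b c j ↦ triple F (embed a) (embed b) (embed c) j
      triple-↦ zero          _ = refl
      triple-↦ (suc zero)    _ = refl
      triple-↦ (suc (suc _)) _ = refl

    module _ (T : Triangle F m) where

      isSide-embed⇔ : ∀ {w w′} → (∀ j → w j ↦ w′ j) → IsSide F w′ (embedTriangle T) ⇔ IsSide F w T
      isSide-embed⇔ w↦w′ = sameSpan-embed⇔ w↦w′ ⊎-⇔ sameSpan-embed⇔ w↦w′ ⊎-⇔ sameSpan-embed⇔ w↦w′

      onTriangle-embed⇔ : ∀ {x v} → x ↦ v → OnTriangle F v (embedTriangle T) ⇔ OnTriangle F x T
      onTriangle-embed⇔ x↦v = inSpan-embed⇔ pair-↦ x↦v ⊎-⇔ inSpan-embed⇔ pair-↦ x↦v ⊎-⇔ inSpan-embed⇔ pair-↦ x↦v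

    embed-inSpan : ∀ x → InSpan F (embed x) g
    embed-inSpan x = x , λ _ → refl

    image⊆span : ∀ {k} (u : Fin k → Vect F m) → SubSpan F (embed ∘ u) g
    image⊆span u = from subSpan⇔members (embed-inSpan ∘ u)

    module _ (T : Triangle F m) where
      open Triangle T

      isSide-embed⇒subSpan : ∀ {w} → IsSide F w (embedTriangle T) → SubSpan F w g
      isSide-embed⇒subSpan {w} =
        isSide⇒subSpan (embedTriangle T) (embed-inSpan a) (embed-inSpan b) (embed-inSpan c) {w}

      onTriangle-embed⇒inSpan : ∀ {v} → OnTriangle F v (embedTriangle T) → InSpan F v g
      onTriangle-embed⇒inSpan =
        onTriangle⇒inSpan (embedTriangle T) (embed-inSpan a) (embed-inSpan b) (embed-inSpan c)

  module Composition {n m t} (D₁ : GDTD F n m) (D₂ : GDTD F m t) where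
    private
      module D₁ = GDTD D₁
      module D₂ = GDTD D₂
      module E (i : Fin D₁.numGroups) = Embedding (D₁.groups i) (D₁.groups-indep i)

    GroupIndex : Set
    GroupIndex = Fin D₁.numGroups × Fin D₂.numGroups

    BlockIndex : Set
    BlockIndex = Fin D₁.numBlocks ⊎ (Fin D₁.numGroups × Fin D₂.numBlocks)

    groups : GroupIndex → Fin t → Vect F n
    groups (i , k) = E.embed i ∘ D₂.groups k

    blocks : BlockIndex → Triangle F n
    blocks (inj₁ j)       = D₁.blocks j
    blocks (inj₂ (i , j)) = E.embedTriangle i (D₂.blocks j)

    groups-indep : ∀ p → LinIndep F (groups p)
    groups-indep (i , k) = from (E.linIndep-embed⇔ i (λ _ _ → refl)) (D₂.groups-indep k)

    points : (v : Vect F n) → NonzeroV F v → ExactlyOne (λ p → InSpan F v (groups p))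
    points v v≢0 with D₁.points v v≢0
    ... | one-group@(i , (x , x↦v) , _) =
      exactlyOne-× (λ {i′} {k} → E.image⊆span i′ (D₂.groups k) v) one-group
        (exactlyOne-⇔ (λ k → ⇔-sym (E.inSpan-embed⇔ i (λ _ _ → refl) x↦v))
          (D₂.points x (E.nonzero-↦ i x↦v v≢0)))

    lines : (w : Fin 2 → Vect F n) → LinIndep F w →
      ExactlyOne⊎ (λ β → IsSide F w (blocks β)) (λ p → SubSpan F w (groups p))
    lines w w-indep =
      exactlyOne⊎-refine (λ {i} {j} → E.isSide-embed⇒subSpan i (D₂.blocks j) {w})
        (λ {i} {k} w⊆ v → E.image⊆span i (D₂.groups k) v ∘ w⊆ v) (D₁.lines w w-indep) fibre
      where
      fibre : ∀ {i} → SubSpan F w (D₁.groups i) →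
        ExactlyOne⊎ (λ j → IsSide F w (blocks (inj₂ (i , j)))) (λ k → SubSpan F w (groups (i , k)))
      fibre {i} w⊆gᵢ =
        exactlyOne⊎-⇔ (λ j → ⇔-sym (E.isSide-embed⇔ i (D₂.blocks j) w′↦w))
                      (λ k → ⇔-sym (E.subSpan-embed⇔ i (λ _ _ → refl) w′↦w))
                      (D₂.lines w′ (to (E.linIndep-embed⇔ i w′↦w) w-indep))
        where
        w′ : Fin 2 → Vect F m
        w′ j = proj₁ (w⊆gᵢ (w j) (inSpan-member w j))
        w′↦w : ∀ j → E._↦_ i (w′ j) (w j)
        w′↦w j = proj₂ (w⊆gᵢ (w j) (inSpan-member w j))

    groupIndex : Fin (D₁.numGroups ℕ.* D₂.numGroups) ↔ GroupIndex
    groupIndex = *↔×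

    blockIndex : Fin (D₁.numBlocks ℕ.+ D₁.numGroups ℕ.* D₂.numBlocks) ↔ BlockIndex
    blockIndex = (↔-id _ ⊎-↔ *↔×) ↔-∘ +↔⊎

    design : GDTD F n t
    design = record
      { numGroups    = D₁.numGroups ℕ.* D₂.numGroups
      ; groups       = groups ∘ Inverse.to groupIndex
      ; groups-indep = groups-indep ∘ Inverse.to groupIndex
      ; numBlocks    = D₁.numBlocks ℕ.+ D₁.numGroups ℕ.* D₂.numBlocks
      ; blocks       = blocks ∘ Inverse.to blockIndex
      ; points       = λ v v≢0 → exactlyOne-↔ groupIndex (points v v≢0)
      ; lines        = λ w w-indep → exactlyOne⊎-↔ blockIndex groupIndex (lines w w-indep)
      }

    module _ (D₁-balanced : Balanced F D₁) (D₂-balanced : Balanced F D₂) where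
      private
        r₁ = proj₁ D₁-balanced
        r₂ = proj₁ D₂-balanced

      trianglesThrough : (v : Vect F n) → NonzeroV F v →
        Σ (List BlockIndex) λ S → Enumerates (λ β → OnTriangle F v (blocks β)) S × length S ≡ r₁ ℕ.+ r₂
      trianglesThrough v v≢0 with D₁.points v v≢0
      ... | i , (x , x↦v) , unique-i with proj₂ D₁-balanced v v≢0 | proj₂ D₂-balanced x (E.nonzero-↦ i x↦v v≢0)
      ... | S₁ , u₁ , m₁ , |S₁| | S₂ , u₂ , m₂ , |S₂| =
        map inj₁ S₁ ++ map inj₂ (map (i ,_) S₂) ,
        enumerates-⊎ (u₁ , m₁)
          (enumerates-fibre (λ {i′} {j} o → unique-i i′ (E.onTriangle-embed⇒inSpan i′ (D₂.blocks j) o))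
            (enumerates-⇔ (λ j → ⇔-sym (E.onTriangle-embed⇔ i (D₂.blocks j) x↦v)) (u₂ , m₂))) ,
        (begin
          length (map inj₁ S₁ ++ map inj₂ (map (i ,_) S₂))
            ≡⟨ length-++ (map inj₁ S₁) ⟩
          length (map inj₁ S₁) ℕ.+ length (map inj₂ (map (i ,_) S₂))
            ≡⟨ cong₂ ℕ._+_ (length-map inj₁ S₁) (trans (length-map inj₂ (map (i ,_) S₂)) (length-map (i ,_) S₂)) ⟩
          length S₁ ℕ.+ length S₂
            ≡⟨ cong₂ ℕ._+_ |S₁| |S₂| ⟩
          r₁ ℕ.+ r₂
            ∎)
        where open ≡-Reasoning

      design-balanced : Balanced F design
      design-balanced = r₁ ℕ.+ r₂ , λ v v≢0 →
        let (S , enumerates , |S|) = trianglesThrough v v≢0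
            (unique , members) = enumerates-↔ blockIndex enumerates
        in map (Inverse.from blockIndex) S , unique , members , trans (length-map _ S) |S|

lemma4 : (F : FiniteField) (n m t : ℕ) → t ∣ m → m ∣ n →
    (GDTD F n m → GDTD F m t → GDTD F n t)
    × ((D₁ : GDTD F n m) → Balanced F D₁ → (D₂ : GDTD F m t) → Balanced F D₂
    → Σ (GDTD F n t) (Balanced F))
-- The construction does not need the divisibility hypotheses.
lemma4 F n m t _ _ =
  (λ D₁ D₂ → design D₁ D₂) ,
  (λ D₁ balanced₁ D₂ balanced₂ → design D₁ D₂ , design-balanced D₁ D₂ balanced₁ balanced₂)
  where open Composition F
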